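{- Let $a$ be an integer with $a>2$ and $S=\langle a,a+1,a+2\rangle$. Every $r\in\operatorname{ULF}(S)$ can be expressed as $r=\alpha a+\beta(a+1)+\gamma(a+2)$ with $\alpha,\gamma\in\mathbb{N}$ and $\beta\in\{0,1\}$, and for such an expression $\operatorname{F}(r,S)=\{(\alpha,\beta,\gamma)+\lambda(-1,2,-1):\lambda\in\{0,\dots,\min\{\alpha,\gamma\}\}\}.$ Moreover, every factorization of $r$ has length $\lfloor r/a\rfloor$.
   Context: $\mathbb{N}=\{0,1,2,\dots\}$; $S=\langle a,a+1,a+2\rangle=\{\alpha_1a+\alpha_2(a+1)+\alpha_3(a+2):\alpha_i\in\mathbb{N}\}$. For $r\in S$, $\operatorname{F}(r,S)=\{\alpha\in\mathbb{N}^3:\alpha_1a+\alpha_2(a+1)+\alpha_3(a+2)=r\}$ (the factorizations of $r$), the length of $\alpha$ is $|\alpha|=\alpha_1+\alpha_2+\alpha_3$, $\operatorname{L}(r,S)=\{|\alpha|:\alpha\in\operatorname{F}(r,S)\}$, and $\operatorname{ULF}(S)=\{r\in S:\operatorname{L}(r,S)\text{ has exactly one element}\}$. -}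

module Defs where

open import Data.Nat using (ℕ; suc; _+_; _*_)
open import Data.Product using (_×_; _,_; ∃-syntax)
open import Relation.Binary.PropositionalEquality using (_≡_)

Triple : Set
Triple = ℕ × ℕ × ℕ

IsFact : ℕ → ℕ → Triple → Set
IsFact a r (x , y , z) = x * a + y * (a + 1) + z * (a + 2) ≡ r

len : Triple → ℕ
len (x , y , z) = x + y + z

InL : ℕ → ℕ → ℕ → Set
InL a r n = ∃[ f ] (IsFact a r f × len f ≡ n)

InULF : ℕ → ℕ → Set
InULF a r = ∃[ n ] (InL a r n × (∀ m → InL a r m → m ≡ n))

module Submission where

-- Write e(x , y , z) = y + 2z, so that x a + y (a + 1) + z (a + 2) = (x + y + z) a + e(x , y , z):
-- whether a triple factorizes r depends only on its length and its excess e.  If every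
-- factorization of r has length n, they all have excess r − n a, and this is < a, since otherwise
-- a units of excess could be traded for one more generator, giving a factorization of length
-- n + 1; hence ⌊r / a⌋ = n.  Among the triples of a given length and excess, the one with middle
-- coordinate at most 1 has the largest third coordinate, and the moves (−1, 2, −1) reach all others
-- from it.

open import Defs
open import Data.Nat using (ℕ; suc; _+_; _*_; _∸_; _≤_; _<_; _⊓_; _/_; NonZero; z≤n; s≤s⁻¹; _≤?_)
open import Data.Nat.Properties
open import Data.Nat.DivMod using (+-distrib-/-∣ˡ; m*n/n≡m; m<n⇒m/n≡0)
open import Data.Nat.Divisibility using (divides-refl)
open import Data.Nat.Tactic.RingSolver using (solve-∀; solve)
open import Data.List using (_∷_; [])
open import Data.Product using (_×_; _,_; ∃-syntax)
open import Relation.Binary.PropositionalEquality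
open import Relation.Nullary using (yes; no; contradiction)

excess : Triple → ℕ
excess (x , y , z) = y + 2 * z

weighted-sum≡len*a+excess : ∀ a x y z →
  x * a + y * (a + 1) + z * (a + 2) ≡ (x + y + z) * a + (y + 2 * z)
weighted-sum≡len*a+excess = solve-∀

isFact⇒len*a+excess≡r : ∀ {a r} f → IsFact a r f → len f * a + excess f ≡ r
isFact⇒len*a+excess≡r {a} (x , y , z) h = trans (sym (weighted-sum≡len*a+excess a x y z)) h

len*a+excess≡r⇒isFact : ∀ {a r} f → len f * a + excess f ≡ r → IsFact a r f
len*a+excess≡r⇒isFact {a} (x , y , z) h = trans (weighted-sum≡len*a+excess a x y z) h

isFact-resp : ∀ {a r} f g → len f ≡ len g → excess f ≡ excess g → IsFact a r f → IsFact a r g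
isFact-resp {a} {r} f g len-eq excess-eq h = len*a+excess≡r⇒isFact g (begin
  len g * a + excess g ≡⟨ cong₂ (λ m e → m * a + e) (sym len-eq) (sym excess-eq) ⟩
  len f * a + excess f ≡⟨ isFact⇒len*a+excess≡r f h ⟩
  r                    ∎)
  where open ≡-Reasoning

excess≤2*len : ∀ f → excess f ≤ 2 * len f
excess≤2*len (x , y , z) = begin
  y + 2 * z                   ≤⟨ m≤m+n (y + 2 * z) (2 * x + y) ⟩
  y + 2 * z + (2 * x + y)     ≡⟨ solve (x ∷ y ∷ z ∷ []) ⟩
  2 * (x + y + z)             ∎
  where open ≤-Reasoning

triple-with-len-excess : ∀ n e → e ≤ 2 * n → ∃[ f ] (len f ≡ n × excess f ≡ e)
triple-with-len-excess n       0             _   = (n , 0 , 0) , trans (+-identityʳ (n + 0)) (+-identityʳ n) , refl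
triple-with-len-excess (suc n) 1             _   = (n , 1 , 0) , trans (+-identityʳ (n + 1)) (+-comm n 1) , refl
triple-with-len-excess (suc n) (suc (suc e)) e≤2n
  with triple-with-len-excess n e (s≤s⁻¹ (s≤s⁻¹ (subst (suc (suc e) ≤_) (*-suc 2 n) e≤2n)))
... | (x , y , z) , refl , refl = (x , y , suc z) , +-suc (x + y) z , excess-step
  where
  excess-step : y + 2 * suc z ≡ suc (suc (y + 2 * z))
  excess-step = solve (y ∷ z ∷ [])

longer-factorization : ∀ {a r} f → IsFact a r f → a ≤ excess f →
  ∃[ g ] (IsFact a r g × len g ≡ suc (len f))
longer-factorization {a} {r} f h a≤e with m≤n⇒∃[o]m+o≡n a≤e
... | d , a+d≡e with triple-with-len-excess (suc (len f)) d d≤2[1+len]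
  where
  d≤2[1+len] : d ≤ 2 * suc (len f)
  d≤2[1+len] = begin
    d              ≤⟨ m≤n+m d a ⟩
    a + d          ≡⟨ a+d≡e ⟩
    excess f       ≤⟨ excess≤2*len f ⟩
    2 * len f      ≤⟨ *-monoʳ-≤ 2 (n≤1+n (len f)) ⟩
    2 * suc (len f) ∎
    where open ≤-Reasoning
... | g , len-g , excess-g = g , len*a+excess≡r⇒isFact g value-g , len-g
  where
  open ≡-Reasoning
  value-g : len g * a + excess g ≡ r
  value-g = begin
    len g * a + excess g     ≡⟨ cong₂ (λ m e → m * a + e) len-g excess-g ⟩
    a + len f * a + d        ≡⟨ cong (_+ d) (+-comm a (len f * a)) ⟩
    len f * a + a + d        ≡⟨ +-assoc (len f * a) a d ⟩
    len f * a + (a + d)      ≡⟨ cong (len f * a +_) a+d≡e ⟩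
    len f * a + excess f     ≡⟨ isFact⇒len*a+excess≡r f h ⟩
    r                        ∎

middle≤1-factorization : ∀ {a r} x y z → IsFact a r (x , y , z) →
  ∃[ α ] ∃[ β ] ∃[ γ ] (β ≤ 1 × IsFact a r (α , β , γ))
middle≤1-factorization x 0             z h = x , 0 , z , z≤n , h
middle≤1-factorization x 1             z h = x , 1 , z , ≤-refl , h
middle≤1-factorization x (suc (suc y)) z h =
  middle≤1-factorization (suc x) y (suc z)
    (isFact-resp (x , 2 + y , z) (suc x , y , suc z) same-len same-excess h)
  where
  same-len : x + (2 + y) + z ≡ suc x + y + suc z
  same-len = solve (x ∷ y ∷ z ∷ [])
  same-excess : 2 + y + 2 * z ≡ y + 2 * suc z
  same-excess = solve (y ∷ z ∷ [])

shift : Triple → ℕ → Triple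
shift (α , β , γ) l = α ∸ l , β + 2 * l , γ ∸ l

shift-isFact : ∀ {a r} α β γ {l} → l ≤ α ⊓ γ → IsFact a r (α , β , γ) →
  IsFact a r (shift (α , β , γ) l)
shift-isFact α β γ {l} l≤α⊓γ
  with m≤n⇒∃[o]m+o≡n (≤-trans l≤α⊓γ (m⊓n≤m α γ)) | m≤n⇒∃[o]m+o≡n (≤-trans l≤α⊓γ (m⊓n≤n α γ))
... | k , refl | k′ , refl =
  isFact-resp (l + k , β , l + k′) (shift (l + k , β , l + k′) l) same-len same-excess
  where
  open ≡-Reasoning
  same-len : l + k + β + (l + k′) ≡ l + k ∸ l + (β + 2 * l) + (l + k′ ∸ l)
  same-len = begin
    l + k + β + (l + k′)       ≡⟨ solve (l ∷ k ∷ β ∷ k′ ∷ []) ⟩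
    k + (β + 2 * l) + k′       ≡⟨ sym (cong₂ (λ m m′ → m + (β + 2 * l) + m′) (m+n∸m≡n l k) (m+n∸m≡n l k′)) ⟩
    l + k ∸ l + (β + 2 * l) + (l + k′ ∸ l) ∎
  same-excess : β + 2 * (l + k′) ≡ β + 2 * l + 2 * (l + k′ ∸ l)
  same-excess = begin
    β + 2 * (l + k′)           ≡⟨ solve (β ∷ l ∷ k′ ∷ []) ⟩
    β + 2 * l + 2 * k′         ≡⟨ sym (cong (λ m → β + 2 * l + 2 * m) (m+n∸m≡n l k′)) ⟩
    β + 2 * l + 2 * (l + k′ ∸ l) ∎

y+2z≡β+2γ⇒z≤γ : ∀ {β γ y z} → β ≤ 1 → y + 2 * z ≡ β + 2 * γ → z ≤ γ
y+2z≡β+2γ⇒z≤γ {β} {γ} {y} {z} β≤1 eq = s≤s⁻¹ (*-cancelˡ-< 2 z (suc γ) (begin-strict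
  2 * z       ≤⟨ m≤n+m (2 * z) y ⟩
  y + 2 * z   ≡⟨ eq ⟩
  β + 2 * γ   ≤⟨ +-monoˡ-≤ (2 * γ) β≤1 ⟩
  1 + 2 * γ   <⟨ n<1+n (1 + 2 * γ) ⟩
  2 + 2 * γ   ≡⟨ sym (*-suc 2 γ) ⟩
  2 * suc γ   ∎))
  where open ≤-Reasoning

shift-complete : ∀ α β γ f → β ≤ 1 → len f ≡ len (α , β , γ) → excess f ≡ excess (α , β , γ) →
  ∃[ l ] (l ≤ α ⊓ γ × f ≡ shift (α , β , γ) l)
shift-complete α β γ (x , y , z) β≤1 same-len same-excess
  with m≤n⇒∃[o]m+o≡n {z} {γ} (y+2z≡β+2γ⇒z≤γ {y = y} β≤1 same-excess)
... | l , refl with y≡β+2l | x+l≡α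
  where
  open ≡-Reasoning
  y≡β+2l : y ≡ β + 2 * l
  y≡β+2l = +-cancelʳ-≡ (2 * z) y (β + 2 * l) (begin
    y + 2 * z             ≡⟨ same-excess ⟩
    β + 2 * (z + l)       ≡⟨ solve (β ∷ z ∷ l ∷ []) ⟩
    β + 2 * l + 2 * z     ∎)
  x+l≡α : x + l ≡ α
  x+l≡α = +-cancelʳ-≡ (β + l + z) (x + l) α (begin
    x + l + (β + l + z)   ≡⟨ solve (x ∷ l ∷ β ∷ z ∷ []) ⟩
    x + (β + 2 * l) + z   ≡⟨ cong (λ m → x + m + z) y≡β+2l ⟨
    x + y + z             ≡⟨ same-len ⟩
    α + β + (z + l)       ≡⟨ solve (α ∷ β ∷ z ∷ l ∷ []) ⟩
    α + (β + l + z)       ∎)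
... | refl | refl = l , ⊓-glb (m≤n+m l x) (m≤n+m l z) ,
  cong₂ _,_ (sym (m+n∸n≡m x l)) (cong (β + 2 * l ,_) (sym (m+n∸n≡m z l)))

module UniqueLength {a r n : ℕ} (len≡n : ∀ f → IsFact a r f → len f ≡ n) where

  n*a+excess≡r : ∀ f → IsFact a r f → n * a + excess f ≡ r
  n*a+excess≡r f h = subst (λ m → m * a + excess f ≡ r) (len≡n f h) (isFact⇒len*a+excess≡r f h)

  excess-unique : ∀ f g → IsFact a r f → IsFact a r g → excess f ≡ excess g
  excess-unique f g hf hg =
    +-cancelˡ-≡ (n * a) (excess f) (excess g) (trans (n*a+excess≡r f hf) (sym (n*a+excess≡r g hg)))

  excess<a : ∀ f → IsFact a r f → excess f < a
  excess<a f h with a ≤? excess f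
  ... | no  a≰e = ≰⇒> a≰e
  ... | yes a≤e = contradiction (longer (longer-factorization f h a≤e)) 1+n≢n
    where
    open ≡-Reasoning
    longer : ∃[ g ] (IsFact a r g × len g ≡ suc (len f)) → suc n ≡ n
    longer (g , hg , len-g) = begin
      suc n       ≡⟨ cong suc (len≡n f h) ⟨
      suc (len f) ≡⟨ len-g ⟨
      len g       ≡⟨ len≡n g hg ⟩
      n           ∎

  r/a≡n : .{{_ : NonZero a}} → ∀ f → IsFact a r f → r / a ≡ n
  r/a≡n f h = begin
    r / a                      ≡⟨ cong (_/ a) (n*a+excess≡r f h) ⟨
    (n * a + excess f) / a     ≡⟨ +-distrib-/-∣ˡ (excess f) (divides-refl n) ⟩
    n * a / a + excess f / a   ≡⟨ cong₂ _+_ (m*n/n≡m n a) (m<n⇒m/n≡0 (excess<a f h)) ⟩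
    n + 0                      ≡⟨ +-identityʳ n ⟩
    n                          ∎
    where open ≡-Reasoning

  factorization-iff-shift : ∀ α β γ → β ≤ 1 → IsFact a r (α , β , γ) → ∀ f →
    (IsFact a r f → ∃[ l ] (l ≤ α ⊓ γ × f ≡ shift (α , β , γ) l))
    × (∃[ l ] (l ≤ α ⊓ γ × f ≡ shift (α , β , γ) l) → IsFact a r f)
  factorization-iff-shift α β γ β≤1 h f =
      (λ hf → shift-complete α β γ f β≤1
                (trans (len≡n f hf) (sym (len≡n (α , β , γ) h)))
                (excess-unique f (α , β , γ) hf h))
    , λ { (l , l≤α⊓γ , refl) → shift-isFact α β γ l≤α⊓γ h }

proposition5p3 : (a : ℕ) → .{{_ : NonZero a}} → 2 < a → (r : ℕ) → InULF a r →
    (∃[ α ] ∃[ β ] ∃[ γ ] (β ≤ 1 × IsFact a r (α , β , γ)))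
    × (∀ α β γ → β ≤ 1 → IsFact a r (α , β , γ) → ∀ (f : Triple) →
        (IsFact a r f → ∃[ l ] (l ≤ α ⊓ γ × f ≡ (α ∸ l , β + 2 * l , γ ∸ l)))
        × (∃[ l ] (l ≤ α ⊓ γ × f ≡ (α ∸ l , β + 2 * l , γ ∸ l)) → IsFact a r f))
    × (∀ (f : Triple) → IsFact a r f → len f ≡ r / a)
proposition5p3 a _ r (n , (f₀@(x₀ , y₀ , z₀) , isFact₀ , _) , unique) =
    middle≤1-factorization x₀ y₀ z₀ isFact₀
  , factorization-iff-shift
  , λ f h → trans (len≡n f h) (sym (r/a≡n f₀ isFact₀))
  where
  len≡n : ∀ f → IsFact a r f → len f ≡ n
  len≡n f h = unique (len f) (f , h , refl)
  open UniqueLength len≡n
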